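{- A finite tree is odd if and only if it has a mirror-bridge.
   Context: For an automorphism $\sigma$ of an undirected graph $G$, fix any orientation $\vec G$ of its edges and let $r$ be the number of edges $(u,v)\in E(\vec G)$ with $(\sigma(v),\sigma(u))\in E(\vec G)$; $\sigma$ is odd if $(-1)^r=-1$ (this does not depend on the chosen orientation). A graph is odd if it has an odd automorphism. An edge $f$ of a tree $T$ is a mirror-bridge if $T$ has an automorphism that swaps the two endpoints of $f$. -}

module Defs where

open import Data.Nat using (ℕ; zero; suc; _+_; _≤_; _<_; _%_)
open import Data.Bool using (Bool; true; false; T; _∧_; if_then_else_)
open import Data.Fin using (Fin; toℕ)
open import Data.Nat using (_<ᵇ_)
open import Data.Fin.Permutation using (Permutation′; _⟨$⟩ʳ_)
open import Data.List using (List; []; _∷_; _++_; length; map; allFin)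
open import Data.Nat.ListAction using (sum)
open import Data.List.Relation.Unary.Unique.Propositional using (Unique)
open import Data.Product using (Σ; _×_; ∃)
open import Relation.Binary.PropositionalEquality using (_≡_)
open import Relation.Nullary using (¬_)

record Graph (n : ℕ) : Set where
  field
    adj   : Fin n → Fin n → Bool
    sym   : ∀ u v → adj u v ≡ adj v u
    irrefl : ∀ u → adj u u ≡ false
open Graph public

module _ {n : ℕ} (G : Graph n) where

  data Walk : Fin n → Fin n → Set where
    here : ∀ {u} → Walk u u
    step : ∀ {u w v} → T (adj G u w) → Walk w v → Walk u v

  Connected : Set
  Connected = ∀ u v → Walk u v

  data IsPath : List (Fin n) → Set where
    single : ∀ {x} → IsPath (x ∷ [])
    cons   : ∀ {x y ys} → T (adj G x y) → IsPath (y ∷ ys) → IsPath (x ∷ y ∷ ys)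

  HasCycle : Set
  HasCycle = Σ (Fin n) λ x → Σ (List (Fin n)) λ ys →
    (2 ≤ length ys) × Unique (x ∷ ys) × IsPath (x ∷ ys ++ x ∷ [])

  IsTree : Set
  IsTree = (0 < n) × Connected × ¬ HasCycle

  IsAutomorphism : Permutation′ n → Set
  IsAutomorphism σ = ∀ u v → adj G (σ ⟨$⟩ʳ u) (σ ⟨$⟩ʳ v) ≡ adj G u v

  oriented : Fin n → Fin n → Bool
  oriented u v = adj G u v ∧ (toℕ u <ᵇ toℕ v)

  reversals : Permutation′ n → ℕ
  reversals σ = sum (map (λ u → sum (map (λ v →
      if oriented u v ∧ oriented (σ ⟨$⟩ʳ v) (σ ⟨$⟩ʳ u) then 1 else 0)
      (allFin n))) (allFin n))

  -- σ is odd iff (-1)^r = -1, i.e. r is odd.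
  IsOddAut : Permutation′ n → Set
  IsOddAut σ = IsAutomorphism σ × (reversals σ % 2 ≡ 1)

  IsOddGraph : Set
  IsOddGraph = ∃ λ σ → IsOddAut σ

  IsMirrorBridge : Fin n → Fin n → Set
  IsMirrorBridge u v = T (adj G u v) × ∃ λ σ → IsAutomorphism σ ×
    (σ ⟨$⟩ʳ u ≡ v) × (σ ⟨$⟩ʳ v ≡ u)

  HasMirrorBridge : Set
  HasMirrorBridge = ∃ λ u → ∃ λ v → IsMirrorBridge u v

module Submission where

-- Say that an automorphism σ flips the edge {x,y} with respect to an
-- orientation o if o directs the image {σx,σy} against the image of o's direction on {x,y}.
-- r(σ) counts the edges σ flips with respect to the orientation by ≺ (increasing index), and the
-- parity of the number of flipped edges is the same for every orientation: reorienting a set D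
-- of edges changes the count by |D| + |σ(D)|, which is even.  So σ is odd iff it flips an odd
-- number of edges for one (any) orientation  [reversals-mod-2].
--
-- Odd ⇒ mirror-bridge, for every finite graph.  Consider the orbits of σ on ordered pairs of
-- vertices.  If no power of σ maps an edge (x , y) to (y , x), then picking, in each union of the
-- orbits of (x , y) and (y , x), a canonical pair and directing (x , y) forwards iff the pair lies
-- in its own orbit gives a σ-invariant orientation.  σ flips no edge for it, so σ is even
-- [PairOrbits].
--
-- Mirror-bridge ⇒ odd, for trees.  Removing a mirror-bridge uv splits the tree into u's side and
-- v's side, which σ exchanges.  Folding the tree (σ on u's side, σ⁻¹ on v's side) gives an
-- automorphism which, for the orientation by ≺ on u's side, transported to v's side and from u's
-- side to v's side across uv, flips exactly the edge uv  [Folding].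

open import Defs hiding (sym)

open import Data.Nat.Properties
  using (+-0-commutativeMonoid; <ᵇ⇒<; <-asym; +-suc; +-comm; *-suc; suc-injective; n<1+n; m+[n∸m]≡n)
open import Algebra.Properties.CommutativeMonoid.Sum +-0-commutativeMonoid
  using (sum-syntax; sum-cong-≗; ∑-distrib-+; ∑-comm; ∑-permute; sum-replicate-zero)
  renaming (sum to ∑)
open import Data.Bool using (Bool; true; false; not; _∧_; _∨_; _xor_; if_then_else_; T)
open import Data.Bool.Properties
  using (T-≡; ∧-zeroʳ; ∨-comm; xor-same; xor-identityʳ; xor-comm; ∧-distribˡ-xor; not-distribˡ-xor)
open import Data.Empty using (⊥)
open import Data.Fin using (Fin; zero; suc; toℕ; fromℕ<; combine; remQuot; _≟_)
open import Data.Fin.Permutation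
  using (Permutation′; _⟨$⟩ʳ_; _⟨$⟩ˡ_; inverseˡ; inverseʳ; _∘ₚ_; permutation)
  renaming (id to idₚ; flip to inverse)
open import Data.Fin.Properties using (toℕ-injective; toℕ-fromℕ<; pigeonhole; any?; remQuot-combine)
open import Data.List using (List; []; _∷_; _++_; length; map; tabulate; allFin)
open import Data.List.Membership.Propositional using (_∈_; _∉_)
open import Data.List.Membership.Propositional.Properties using (∈-map⁻)
open import Data.List.Properties using (map-tabulate)
open import Data.List.Relation.Binary.Subset.Propositional using (_⊆_)
open import Data.List.Relation.Unary.All using ([])
open import Data.List.Relation.Unary.All.Properties.Core using (¬Any⇒All¬)
open import Data.List.Relation.Unary.AllPairs using ([]; _∷_)
open import Data.List.Relation.Unary.Any using (here; there)
open import Data.List.Relation.Unary.Unique.Propositional using (Unique)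
open import Data.Maybe using (Maybe; just; nothing; maybe′)
import Data.Maybe as Maybe
open import Data.Nat using (ℕ; zero; suc; _+_; _∸_; _*_; _%_; _/_; _<ᵇ_; _≤_; s≤s; z≤n)
open import Data.Nat.DivMod using (m≡m%n+[m/n]*n; m%n<n)
import Data.Nat.ListAction as List
open import Data.Product using (∃; _×_; _,_; proj₁; proj₂)
open import Data.Product.Properties using (≡-dec; ,-injective)
open import Data.Sum using (_⊎_; inj₁; inj₂)
import Data.Sum as Sum
open import Function using (_∘_; id)
open import Function.Bundles using (_⇔_; mk⇔; Equivalence)
open import Relation.Binary.Definitions using (DecidableEquality)
open import Relation.Binary.PropositionalEquality
open import Relation.Nullary using (¬_; Dec; map′)
open import Relation.Nullary.Decidable
  using (does; yes; no; does-⇔; dec-true; dec-false; T?; _×-dec_; _⊎-dec_)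
open import Relation.Nullary.Negation using (contradiction)

≡true⇒T : ∀ {b} → b ≡ true → T b
≡true⇒T = Equivalence.from T-≡

xor-recover : ∀ a b → a ≡ b xor (a xor b)
xor-recover false b = sym (xor-same b)
xor-recover true false = refl
xor-recover true true = refl

not-xor-not : ∀ a b → not a xor not b ≡ a xor b
not-xor-not false false = refl
not-xor-not false true = refl
not-xor-not true false = refl
not-xor-not true true = refl

xor-cancelʳ : ∀ a b t → (a xor t) xor (b xor t) ≡ a xor b
xor-cancelʳ a b false = cong₂ _xor_ (xor-identityʳ a) (xor-identityʳ b)
xor-cancelʳ false false true = refl
xor-cancelʳ false true true = refl
xor-cancelʳ true false true = refl
xor-cancelʳ true true true = refl

exactly-one : ∀ {P Q : Set} (p? : Dec P) (q? : Dec Q) → ¬ (P × Q) → T (does p? ∨ does q?) →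
  does q? ≡ not (does p?)
exactly-one (yes p) (yes q) exclusive _ = contradiction (p , q) exclusive
exactly-one (yes _) (no _) _ _ = refl
exactly-one (no _) (yes _) _ _ = refl

maybe′-cong : ∀ {A B : Set} {g h : A → B} (b : B) → (∀ a → g a ≡ h a) →
  ∀ m → maybe′ g b m ≡ maybe′ h b m
maybe′-cong b g≗h (just a) = g≗h a
maybe′-cong b g≗h nothing = refl

bit : Bool → ℕ
bit b = if b then 1 else 0

parity : ℕ → Bool
parity zero = false
parity (suc n) = not (parity n)

parity-+ : ∀ m n → parity (m + n) ≡ parity m xor parity n
parity-+ zero n = refl
parity-+ (suc m) n = trans (cong not (parity-+ m n)) (not-distribˡ-xor (parity m) (parity n))

%2≡bit-parity : ∀ n → n % 2 ≡ bit (parity n)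
%2≡bit-parity zero = refl
%2≡bit-parity (suc zero) = refl
%2≡bit-parity (suc (suc n)) with parity n | %2≡bit-parity n
... | true | n%2≡1 = n%2≡1
... | false | n%2≡0 = n%2≡0

double-injective : ∀ m k → m + m ≡ k + k → m ≡ k
double-injective zero zero _ = refl
double-injective (suc m) (suc k) eq =
  cong suc (double-injective m k (suc-injective (trans (sym (+-suc m m)) (trans (suc-injective eq) (+-suc k k)))))

count : ∀ {n} → (Fin n → Fin n → Bool) → ℕ
count {n} R = ∑[ x < n ] ∑[ y < n ] bit (R x y)

count-cong : ∀ {n} {R S : Fin n → Fin n → Bool} → (∀ x y → R x y ≡ S x y) → count R ≡ count S
count-cong R≗S = sum-cong-≗ (λ x → sum-cong-≗ (λ y → cong bit (R≗S x y)))

count-transpose : ∀ {n} (R : Fin n → Fin n → Bool) → count (λ x y → R y x) ≡ count R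
count-transpose R = ∑-comm (λ x y → bit (R y x))

count-permute : ∀ {n} (π : Permutation′ n) (R : Fin n → Fin n → Bool) →
  count (λ x y → R (π ⟨$⟩ʳ x) (π ⟨$⟩ʳ y)) ≡ count R
count-permute π R = begin
  count (λ x y → R (π ⟨$⟩ʳ x) (π ⟨$⟩ʳ y))
    ≡⟨ sum-cong-≗ (λ x → sym (∑-permute (λ y → bit (R (π ⟨$⟩ʳ x) y)) π)) ⟩
  ∑ (λ x → ∑ (λ y → bit (R (π ⟨$⟩ʳ x) y)))
    ≡⟨ sym (∑-permute (λ x → ∑ (λ y → bit (R x y))) π) ⟩
  count R ∎
  where open ≡-Reasoning

∑∑-+ : ∀ {n} (f g : Fin n → Fin n → ℕ) →
  ∑[ x < n ] ∑[ y < n ] (f x y + g x y) ≡ ∑[ x < n ] ∑[ y < n ] f x y + ∑[ x < n ] ∑[ y < n ] g x y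
∑∑-+ f g = trans (sum-cong-≗ (λ x → ∑-distrib-+ (f x) (g x))) (∑-distrib-+ (∑ ∘ f) (∑ ∘ g))

count-split : ∀ {n} {Q R S : Fin n → Fin n → Bool} →
  (∀ x y → bit (Q x y) ≡ bit (R x y) + bit (S x y)) → count Q ≡ count R + count S
count-split {R = R} {S} split =
  trans (sum-cong-≗ (λ x → sum-cong-≗ (split x))) (∑∑-+ (λ x y → bit (R x y)) (λ x y → bit (S x y)))

count-empty : ∀ {n} → count {n} (λ _ _ → false) ≡ 0
count-empty {n} = trans (sum-cong-≗ {n} (λ _ → sum-replicate-zero n)) (sum-replicate-zero n)

sum-point : ∀ {n} (a : Fin n) → ∑[ x < n ] bit (does (x ≟ a)) ≡ 1
sum-point {suc n} zero = cong suc (sum-replicate-zero n)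
sum-point {suc n} (suc a) = sum-point {n} a

count-point : ∀ {n} (a b : Fin n) → count (λ x y → does (x ≟ a) ∧ does (y ≟ b)) ≡ 1
count-point {n} a b = trans (sum-cong-≗ row) (sum-point a)
  where
  row : ∀ x → ∑[ y < n ] bit (does (x ≟ a) ∧ does (y ≟ b)) ≡ bit (does (x ≟ a))
  row x with x ≟ a
  ... | yes _ = sum-point b
  ... | no _ = sum-replicate-zero n

parity-∑-cong : ∀ {n} {f g : Fin n → ℕ} → (∀ i → parity (f i) ≡ parity (g i)) →
  parity (∑ f) ≡ parity (∑ g)
parity-∑-cong {zero} eq = refl
parity-∑-cong {suc n} {f} {g} eq = begin
  parity (f zero + ∑ (f ∘ suc))              ≡⟨ parity-+ (f zero) _ ⟩
  parity (f zero) xor parity (∑ (f ∘ suc))   ≡⟨ cong₂ _xor_ (eq zero) (parity-∑-cong (eq ∘ suc)) ⟩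
  parity (g zero) xor parity (∑ (g ∘ suc))   ≡⟨ parity-+ (g zero) _ ⟨
  parity (g zero + ∑ (g ∘ suc))              ∎
  where open ≡-Reasoning

parity-bit-xor : ∀ a b → parity (bit (a xor b)) ≡ parity (bit a + bit b)
parity-bit-xor false b = refl
parity-bit-xor true false = refl
parity-bit-xor true true = refl

count-parity-xor : ∀ {n} (R S : Fin n → Fin n → Bool) →
  parity (count (λ x y → R x y xor S x y)) ≡ parity (count R) xor parity (count S)
count-parity-xor R S = begin
  parity (count (λ x y → R x y xor S x y))
    ≡⟨ parity-∑-cong (λ x → parity-∑-cong (λ y → parity-bit-xor (R x y) (S x y))) ⟩
  parity (∑ (λ x → ∑ (λ y → bit (R x y) + bit (S x y))))
    ≡⟨ cong parity (∑∑-+ (λ x y → bit (R x y)) (λ x y → bit (S x y))) ⟩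
  parity (count R + count S)
    ≡⟨ parity-+ (count R) (count S) ⟩
  parity (count R) xor parity (count S) ∎
  where open ≡-Reasoning

listSum-allFin : ∀ {n} (f : Fin n → ℕ) → List.sum (map f (allFin n)) ≡ ∑ f
listSum-allFin f = trans (cong List.sum (map-tabulate id f)) (listSum-tabulate f)
  where
  listSum-tabulate : ∀ {n} (f : Fin n → ℕ) → List.sum (tabulate f) ≡ ∑ f
  listSum-tabulate {zero} f = refl
  listSum-tabulate {suc n} f = cong (f zero +_) (listSum-tabulate (f ∘ suc))

_≺_ : ∀ {n} → Fin n → Fin n → Bool
x ≺ y = toℕ x <ᵇ toℕ y

≺-asym : ∀ {n} {x y : Fin n} → T (x ≺ y) → ¬ T (y ≺ x)
≺-asym {x = x} {y} x≺y y≺x = <-asym (<ᵇ⇒< (toℕ x) (toℕ y) x≺y) (<ᵇ⇒< (toℕ y) (toℕ x) y≺x)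

≺-flip : ∀ {n} (x y : Fin n) → x ≢ y → (y ≺ x) ≡ not (x ≺ y)
≺-flip x y x≢y = flip (toℕ x) (toℕ y) (x≢y ∘ toℕ-injective)
  where
  flip : ∀ a b → a ≢ b → (b <ᵇ a) ≡ not (a <ᵇ b)
  flip zero zero a≢b = contradiction refl a≢b
  flip zero (suc b) _ = refl
  flip (suc a) zero _ = refl
  flip (suc a) (suc b) a≢b = flip a b (a≢b ∘ cong suc)

⟨$⟩ʳ-injective : ∀ {n} (π : Permutation′ n) {x y} → π ⟨$⟩ʳ x ≡ π ⟨$⟩ʳ y → x ≡ y
⟨$⟩ʳ-injective π eq = trans (sym (inverseˡ π)) (trans (cong (π ⟨$⟩ˡ_) eq) (inverseˡ π))

inverse-automorphism : ∀ {n} (G : Graph n) {σ} → IsAutomorphism G σ → IsAutomorphism G (inverse σ)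
inverse-automorphism G {σ} aut x y =
  trans (sym (aut (σ ⟨$⟩ˡ x) (σ ⟨$⟩ˡ y))) (cong₂ (adj G) (inverseʳ σ) (inverseʳ σ))

adj⇒≢ : ∀ {n} (G : Graph n) {x y} → T (adj G x y) → x ≢ y
adj⇒≢ G {x} xy refl rewrite irrefl G x = xy

adj-sym : ∀ {n} (G : Graph n) {x y} → T (adj G x y) → T (adj G y x)
adj-sym G {x} {y} = subst T (Graph.sym G x y)

module _ {n : ℕ} (G : Graph n) where

  -- o orients each edge {x,y}: o x y says whether it points from x to y.
  IsOrientation : (Fin n → Fin n → Bool) → Set
  IsOrientation o = ∀ x y → T (adj G x y) → o y x ≡ not (o x y)

  EdgeSymmetric : (Fin n → Fin n → Bool) → Set
  EdgeSymmetric h = ∀ x y → T (adj G x y) → h y x ≡ h x y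

  edgeCount : (Fin n → Fin n → Bool) → ℕ
  edgeCount h = count (λ x y → adj G x y ∧ x ≺ y ∧ h x y)

  ≺-isOrientation : IsOrientation _≺_
  ≺-isOrientation x y xy = ≺-flip x y (adj⇒≢ G xy)

  edgeCount-cong : ∀ {h h′} → (∀ x y → T (adj G x y) → h x y ≡ h′ x y) → edgeCount h ≡ edgeCount h′
  edgeCount-cong {h} {h′} h≗h′ = count-cong agree
    where
    agree : ∀ x y → (adj G x y ∧ x ≺ y ∧ h x y) ≡ (adj G x y ∧ x ≺ y ∧ h′ x y)
    agree x y with adj G x y in xy
    ... | false = refl
    ... | true = cong (x ≺ y ∧_) (h≗h′ x y (≡true⇒T xy))

  edgeCount-double : ∀ {h} → EdgeSymmetric h → count (λ x y → adj G x y ∧ h x y) ≡ edgeCount h + edgeCount h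
  edgeCount-double {h} h-sym = begin
    count (λ x y → adj G x y ∧ h x y)   ≡⟨ count-split split ⟩
    edgeCount h + count (λ x y → P y x) ≡⟨ cong (edgeCount h +_) (count-transpose P) ⟩
    edgeCount h + edgeCount h           ∎
    where
    open ≡-Reasoning
    P : Fin n → Fin n → Bool
    P x y = adj G x y ∧ x ≺ y ∧ h x y
    split : ∀ x y → bit (adj G x y ∧ h x y) ≡ bit (P x y) + bit (P y x)
    split x y rewrite Graph.sym G y x with adj G x y in xy
    ... | false = refl
    ... | true rewrite ≺-isOrientation x y (≡true⇒T xy) | h-sym x y (≡true⇒T xy) with x ≺ y | h x y
    ... | false | false = refl
    ... | false | true = refl
    ... | true | false = refl
    ... | true | true = refl

  edgeCount-invariant : ∀ {σ h} → IsAutomorphism G σ → EdgeSymmetric h →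
    edgeCount (λ x y → h (σ ⟨$⟩ʳ x) (σ ⟨$⟩ʳ y)) ≡ edgeCount h
  edgeCount-invariant {σ} {h} aut h-sym = double-injective _ _ (begin
    edgeCount hσ + edgeCount hσ                   ≡⟨ edgeCount-double hσ-sym ⟨
    count (λ x y → adj G x y ∧ hσ x y)           ≡⟨ count-cong (λ x y → cong (_∧ hσ x y) (aut x y)) ⟨
    count (λ x y → adj G (σ ⟨$⟩ʳ x) (σ ⟨$⟩ʳ y) ∧ hσ x y) ≡⟨ count-permute σ (λ x y → adj G x y ∧ h x y) ⟩
    count (λ x y → adj G x y ∧ h x y)            ≡⟨ edgeCount-double h-sym ⟩
    edgeCount h + edgeCount h                     ∎)
    where
    open ≡-Reasoning
    hσ : Fin n → Fin n → Bool
    hσ x y = h (σ ⟨$⟩ʳ x) (σ ⟨$⟩ʳ y)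
    hσ-sym : EdgeSymmetric hσ
    hσ-sym x y xy = h-sym (σ ⟨$⟩ʳ x) (σ ⟨$⟩ʳ y) (subst T (sym (aut x y)) xy)

  edgeCount-parity-xor : ∀ h h′ →
    parity (edgeCount (λ x y → h x y xor h′ x y)) ≡ parity (edgeCount h) xor parity (edgeCount h′)
  edgeCount-parity-xor h h′ =
    trans (cong parity (count-cong distrib))
          (count-parity-xor (λ x y → adj G x y ∧ x ≺ y ∧ h x y) (λ x y → adj G x y ∧ x ≺ y ∧ h′ x y))
    where
    distrib : ∀ x y → (adj G x y ∧ x ≺ y ∧ (h x y xor h′ x y))
                    ≡ ((adj G x y ∧ x ≺ y ∧ h x y) xor (adj G x y ∧ x ≺ y ∧ h′ x y))
    distrib x y = trans (cong (adj G x y ∧_) (∧-distribˡ-xor (x ≺ y) (h x y) (h′ x y)))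
                        (∧-distribˡ-xor (adj G x y) _ _)

  flipped : (Fin n → Fin n → Bool) → Permutation′ n → Fin n → Fin n → Bool
  flipped o σ x y = o (σ ⟨$⟩ʳ x) (σ ⟨$⟩ʳ y) xor o x y

  flipped-parity-invariant : ∀ {σ o o′} → IsAutomorphism G σ → IsOrientation o → IsOrientation o′ →
    parity (edgeCount (flipped o σ)) ≡ parity (edgeCount (flipped o′ σ))
  flipped-parity-invariant {σ} {o} {o′} aut o-or o′-or = begin
    parity (edgeCount (flipped o σ))
      ≡⟨ edgeCount-parity-xor (along σ o) o ⟩
    parity (edgeCount (along σ o)) xor parity (edgeCount o)
      ≡⟨ cong₂ (λ p q → parity p xor parity q)
               (edgeCount-cong (λ x y _ → xor-recover (along σ o x y) (along σ o′ x y)))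
               (edgeCount-cong (λ x y _ → xor-recover (o x y) (o′ x y))) ⟩
    parity (edgeCount (λ x y → along σ o′ x y xor along σ t x y))
      xor parity (edgeCount (λ x y → o′ x y xor t x y))
      ≡⟨ cong₂ _xor_ (edgeCount-parity-xor (along σ o′) (along σ t)) (edgeCount-parity-xor o′ t) ⟩
    (parity (edgeCount (along σ o′)) xor parity (edgeCount (along σ t)))
      xor (parity (edgeCount o′) xor parity (edgeCount t))
      ≡⟨ cong (λ k → (parity (edgeCount (along σ o′)) xor parity k)
                       xor (parity (edgeCount o′) xor parity (edgeCount t)))
              (edgeCount-invariant {σ} {t} aut t-sym) ⟩
    (parity (edgeCount (along σ o′)) xor parity (edgeCount t))
      xor (parity (edgeCount o′) xor parity (edgeCount t))
      ≡⟨ xor-cancelʳ (parity (edgeCount (along σ o′))) (parity (edgeCount o′)) (parity (edgeCount t)) ⟩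
    parity (edgeCount (along σ o′)) xor parity (edgeCount o′)
      ≡⟨ edgeCount-parity-xor (along σ o′) o′ ⟨
    parity (edgeCount (flipped o′ σ)) ∎
    where
    open ≡-Reasoning
    along : Permutation′ n → (Fin n → Fin n → Bool) → Fin n → Fin n → Bool
    along π r x y = r (π ⟨$⟩ʳ x) (π ⟨$⟩ʳ y)
    t : Fin n → Fin n → Bool
    t x y = o x y xor o′ x y
    t-sym : EdgeSymmetric t
    t-sym x y xy = trans (cong₂ _xor_ (o-or x y xy) (o′-or x y xy)) (not-xor-not (o x y) (o′ x y))

  reversals-≺ : ∀ {σ} → IsAutomorphism G σ → reversals G σ ≡ edgeCount (flipped _≺_ σ)
  reversals-≺ {σ} aut = begin
    reversals G σ
      ≡⟨ listSum-allFin (λ u → List.sum (map (λ v → bit (reversedPair u v)) (allFin n))) ⟩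
    ∑ (λ u → List.sum (map (λ v → bit (reversedPair u v)) (allFin n)))
      ≡⟨ sum-cong-≗ {n} (λ u → listSum-allFin (λ v → bit (reversedPair u v))) ⟩
    count reversedPair                                     ≡⟨ count-cong reversed ⟩
    edgeCount (flipped _≺_ σ)                              ∎
    where
    open ≡-Reasoning
    s : Fin n → Fin n
    s = σ ⟨$⟩ʳ_
    reversedPair : Fin n → Fin n → Bool
    reversedPair u v = oriented G u v ∧ oriented G (s v) (s u)
    reversed : ∀ u v → reversedPair u v ≡ (adj G u v ∧ u ≺ v ∧ flipped _≺_ σ u v)
    reversed u v with adj G u v in uv | u ≺ v
    ... | false | _ = refl
    ... | true | false = refl
    ... | true | true
      rewrite aut v u | Graph.sym G v u | uv
            | ≺-flip (s u) (s v) (adj⇒≢ G (subst T (sym (aut u v)) (≡true⇒T uv)))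
      = xor-comm true (s u ≺ s v)

  reversals-mod-2 : ∀ {σ o} → IsAutomorphism G σ → IsOrientation o →
    reversals G σ % 2 ≡ bit (parity (edgeCount (flipped o σ)))
  reversals-mod-2 {σ} {o} aut o-or = begin
    reversals G σ % 2                            ≡⟨ %2≡bit-parity (reversals G σ) ⟩
    bit (parity (reversals G σ))                 ≡⟨ cong (bit ∘ parity) (reversals-≺ {σ} aut) ⟩
    bit (parity (edgeCount (flipped _≺_ σ)))     ≡⟨ cong bit (flipped-parity-invariant {σ} aut ≺-isOrientation o-or) ⟩
    bit (parity (edgeCount (flipped o σ)))       ∎
    where open ≡-Reasoning

IsPair : ∀ {n} → Fin n → Fin n → Fin n → Fin n → Set
IsPair u v x y = (x ≡ u × y ≡ v) ⊎ (x ≡ v × y ≡ u)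

pair? : ∀ {n} (u v x y : Fin n) → Dec (IsPair u v x y)
pair? u v x y = (x ≟ u ×-dec y ≟ v) ⊎-dec (x ≟ v ×-dec y ≟ u)

edgeCount-pair-ordered : ∀ {n} (G : Graph n) {a b} → T (adj G a b) → T (a ≺ b) →
  edgeCount G (λ x y → does (pair? a b x y)) ≡ 1
edgeCount-pair-ordered G {a} {b} ab a≺b = trans
  (count-cong (λ x y → does-⇔ (mk⇔ to from) (T? (adj G x y) ×-dec T? (x ≺ y) ×-dec pair? a b x y)
                                             (x ≟ a ×-dec y ≟ b)))
  (count-point a b)
  where
  to : ∀ {x y} → T (adj G x y) × T (x ≺ y) × IsPair a b x y → x ≡ a × y ≡ b
  to (_ , _ , inj₁ x≡a×y≡b) = x≡a×y≡b
  to (_ , b≺a , inj₂ (refl , refl)) = contradiction b≺a (≺-asym {x = a} {b} a≺b)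
  from : ∀ {x y} → x ≡ a × y ≡ b → T (adj G x y) × T (x ≺ y) × IsPair a b x y
  from (refl , refl) = ab , a≺b , inj₁ (refl , refl)

edgeCount-pair : ∀ {n} (G : Graph n) {u v} → T (adj G u v) → edgeCount G (λ x y → does (pair? u v x y)) ≡ 1
edgeCount-pair G {u} {v} uv with u ≺ v in u≺v
... | true = edgeCount-pair-ordered G uv (≡true⇒T u≺v)
... | false = trans
  (edgeCount-cong G (λ x y _ → does-⇔ (mk⇔ Sum.swap Sum.swap) (pair? u v x y) (pair? v u x y)))
  (edgeCount-pair-ordered G (adj-sym G uv) (≡true⇒T (trans (≺-isOrientation G u v uv) (cong not u≺v))))

firstTrue : ∀ {N} → (Fin N → Bool) → Maybe (Fin N)
firstTrue {zero} p = nothing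
firstTrue {suc N} p = if p zero then just zero else Maybe.map suc (firstTrue (p ∘ suc))

firstTrue-cong : ∀ {N} {p q : Fin N → Bool} → (∀ i → p i ≡ q i) → firstTrue p ≡ firstTrue q
firstTrue-cong {zero} p≗q = refl
firstTrue-cong {suc N} {p} {q} p≗q =
  cong₂ (λ b r → if b then just zero else Maybe.map suc r) (p≗q zero) (firstTrue-cong (p≗q ∘ suc))

firstTrue-found : ∀ {N} (p : Fin N → Bool) i → T (p i) → ∃ λ k → firstTrue p ≡ just k × T (p k)
firstTrue-found {suc N} p i pi with p zero in p0
... | true = zero , refl , ≡true⇒T p0
firstTrue-found {suc N} p zero pi | false = contradiction (subst T p0 pi) λ ()
firstTrue-found {suc N} p (suc i) pi | false with firstTrue-found (p ∘ suc) i pi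
... | k , found , pk = suc k , cong (Maybe.map suc) found , pk

module Orbits {A : Set} (_≟ᴬ_ : DecidableEquality A)
              {m : ℕ} (code : A → Fin m) (code-injective : ∀ {a b} → code a ≡ code b → a ≡ b)
              (f : A → A) (f-injective : ∀ {a b} → f a ≡ f b → a ≡ b) where

  open import Function.Endo.Propositional A using (_^_; ^-homo)

  ^-+ : ∀ i j a → (f ^ (i + j)) a ≡ (f ^ i) ((f ^ j) a)
  ^-+ i j a = cong (λ g → g a) (^-homo f i j)

  ^-injective : ∀ k {a b} → (f ^ k) a ≡ (f ^ k) b → a ≡ b
  ^-injective zero eq = eq
  ^-injective (suc k) eq = ^-injective k (f-injective eq)

  -- Every point is periodic: two of its first m + 1 iterates have the same code,
  -- and f is injective.
  period : ∀ a → ∃ λ p → (f ^ suc p) a ≡ a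
  period a with pigeonhole (n<1+n m) (λ (i : Fin (suc m)) → code ((f ^ toℕ i) a))
  ... | i , j , i<j , same-code = p , ^-injective (toℕ i) (begin
    (f ^ toℕ i) ((f ^ suc p) a)  ≡⟨ ^-+ (toℕ i) (suc p) a ⟨
    (f ^ (toℕ i + suc p)) a      ≡⟨ cong (λ k → (f ^ k) a) i+p+1≡j ⟩
    (f ^ toℕ j) a                ≡⟨ code-injective same-code ⟨
    (f ^ toℕ i) a                ∎)
    where
    open ≡-Reasoning
    p : ℕ
    p = toℕ j ∸ suc (toℕ i)
    i+p+1≡j : toℕ i + suc p ≡ toℕ j
    i+p+1≡j = trans (+-suc (toℕ i) p) (m+[n∸m]≡n i<j)

  ^-period-multiple : ∀ {a p} → (f ^ suc p) a ≡ a → ∀ q → (f ^ (q * suc p)) a ≡ a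
  ^-period-multiple fixed zero = refl
  ^-period-multiple {a} {p} fixed (suc q) =
    trans (^-+ (suc p) (q * suc p) a) (trans (cong (f ^ suc p) (^-period-multiple fixed q)) fixed)

  Reach : A → A → Set
  Reach a b = ∃ λ k → (f ^ k) a ≡ b

  reach-refl : ∀ a → Reach a a
  reach-refl a = 0 , refl

  reach-step : ∀ a → Reach a (f a)
  reach-step a = 1 , refl

  reach-trans : ∀ {a b c} → Reach a b → Reach b c → Reach a c
  reach-trans {a} (i , fⁱa≡b) (j , fʲb≡c) = j + i , trans (^-+ j i a) (trans (cong (f ^ j) fⁱa≡b) fʲb≡c)

  -- Orbits are cycles: going around the period of a, b leads back to a.
  reach-sym : ∀ {a b} → Reach a b → Reach b a
  reach-sym {a} {b} (k , fᵏa≡b) with period a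
  ... | p , fixed = k * p , (begin
    (f ^ (k * p)) b              ≡⟨ cong (f ^ (k * p)) fᵏa≡b ⟨
    (f ^ (k * p)) ((f ^ k) a)    ≡⟨ ^-+ (k * p) k a ⟨
    (f ^ (k * p + k)) a          ≡⟨ cong (λ e → (f ^ e) a) (trans (+-comm (k * p) k) (sym (*-suc k p))) ⟩
    (f ^ (k * suc p)) a          ≡⟨ ^-period-multiple fixed k ⟩
    a                            ∎)
    where open ≡-Reasoning

  -- Reachability is decidable: it suffices to search the iterates up to the period.
  reach? : ∀ a b → Dec (Reach a b)
  reach? a b with period a
  ... | p , fixed = map′ (λ (i , eq) → toℕ i , eq) shorten (any? (λ (i : Fin (suc p)) → (f ^ toℕ i) a ≟ᴬ b))
    where
    shorten : Reach a b → ∃ λ (i : Fin (suc p)) → (f ^ toℕ i) a ≡ b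
    shorten (k , fᵏa≡b) = fromℕ< (m%n<n k (suc p)) , (begin
      (f ^ toℕ (fromℕ< (m%n<n k (suc p)))) a             ≡⟨ cong (λ e → (f ^ e) a) (toℕ-fromℕ< (m%n<n k (suc p))) ⟩
      (f ^ (k % suc p)) a                                 ≡⟨ cong (f ^ (k % suc p)) (^-period-multiple fixed (k / suc p)) ⟨
      (f ^ (k % suc p)) ((f ^ ((k / suc p) * suc p)) a)  ≡⟨ ^-+ (k % suc p) _ a ⟨
      (f ^ (k % suc p + (k / suc p) * suc p)) a          ≡⟨ cong (λ e → (f ^ e) a) (m≡m%n+[m/n]*n k (suc p)) ⟨
      (f ^ k) a                                           ≡⟨ fᵏa≡b ⟩
      b                                                   ∎)
      where open ≡-Reasoning

  reach-map : (g : A → A) → (∀ a → g (f a) ≡ f (g a)) → ∀ {a b} → Reach a b → Reach (g a) (g b)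
  reach-map g commute {a} (k , fᵏa≡b) = k , trans (sym (commute-^ k a)) (cong g fᵏa≡b)
    where
    commute-^ : ∀ k a → g ((f ^ k) a) ≡ (f ^ k) (g a)
    commute-^ zero a = refl
    commute-^ (suc k) a = trans (commute ((f ^ k) a)) (cong f (commute-^ k a))

module PairOrbits {n : ℕ} (G : Graph n) (σ : Permutation′ n) (aut : IsAutomorphism G σ) where

  Pair : Set
  Pair = Fin n × Fin n

  σ₂ : Pair → Pair
  σ₂ (x , y) = σ ⟨$⟩ʳ x , σ ⟨$⟩ʳ y

  reverse : Pair → Pair
  reverse (x , y) = y , x

  σ₂-injective : ∀ {d e} → σ₂ d ≡ σ₂ e → d ≡ e
  σ₂-injective eq with ,-injective eq
  ... | x≡ , y≡ = cong₂ _,_ (⟨$⟩ʳ-injective σ x≡) (⟨$⟩ʳ-injective σ y≡)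

  code : Pair → Fin (n * n)
  code (x , y) = combine x y

  decode-code : ∀ d → remQuot n (code d) ≡ d
  decode-code (x , y) = remQuot-combine x y

  code-injective : ∀ {d e} → code d ≡ code e → d ≡ e
  code-injective {d} {e} eq = trans (sym (decode-code d)) (trans (cong (remQuot n) eq) (decode-code e))

  open import Function.Endo.Propositional Pair using (_^_)
  open Orbits (≡-dec _≟_ _≟_) code code-injective σ₂ σ₂-injective

  power : ℕ → Permutation′ n
  power zero = idₚ
  power (suc k) = power k ∘ₚ σ

  power-automorphism : ∀ k → IsAutomorphism G (power k)
  power-automorphism zero u v = refl
  power-automorphism (suc k) u v = trans (aut _ _) (power-automorphism k u v)

  power-pair : ∀ k x y → (σ₂ ^ k) (x , y) ≡ (power k ⟨$⟩ʳ x , power k ⟨$⟩ʳ y)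
  power-pair zero x y = refl
  power-pair (suc k) x y = cong σ₂ (power-pair k x y)

  reversed⇒mirrorBridge : ∀ {x y} → T (adj G x y) → Reach (x , y) (y , x) → IsMirrorBridge G x y
  reversed⇒mirrorBridge {x} {y} xy (k , reversed) with ,-injective (trans (sym (power-pair k x y)) reversed)
  ... | x↦y , y↦x = xy , power k , power-automorphism k , x↦y , y↦x

  -- c is in the σ₂-orbit of d or of its reversal: a relation invariant under σ₂ and reversal.
  related : Pair → Pair → Bool
  related d c = does (reach? d c) ∨ does (reach? (reverse d) c)

  -- The orientation: among the pairs related to (x , y), pick the first one c in the fixed
  -- enumeration, and orient (x , y) forwards iff c is in the orbit of (x , y) itself.
  candidate : Pair → Maybe (Fin (n * n))
  candidate d = firstTrue (λ k → related d (remQuot n k))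

  inOrbit : Pair → Fin (n * n) → Bool
  inOrbit d k = does (reach? d (remQuot n k))

  orient : Fin n → Fin n → Bool
  orient x y = maybe′ (inOrbit (x , y)) false (candidate (x , y))

  reach-σ₂ : ∀ d c → does (reach? (σ₂ d) c) ≡ does (reach? d c)
  reach-σ₂ d c = does-⇔ (mk⇔ (reach-trans (reach-step d)) (reach-trans (reach-sym (reach-step d))))
                        (reach? (σ₂ d) c) (reach? d c)

  orient-invariant : ∀ x y → orient (σ ⟨$⟩ʳ x) (σ ⟨$⟩ʳ y) ≡ orient x y
  orient-invariant x y = trans
    (cong (maybe′ (inOrbit (σ₂ (x , y))) false)
          (firstTrue-cong (λ k → cong₂ _∨_ (reach-σ₂ (x , y) (remQuot n k)) (reach-σ₂ (y , x) (remQuot n k)))))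
    (maybe′-cong false (λ k → reach-σ₂ (x , y) (remQuot n k)) (candidate (x , y)))

  disjoint-orbits : ∀ d c → ¬ Reach d (reverse d) → ¬ (Reach d c × Reach (reverse d) c)
  disjoint-orbits d c d↛d′ (d↝c , d′↝c) =
    d↛d′ (reach-trans (reach-map reverse (λ _ → refl) d′↝c) (reach-sym (reach-map reverse (λ _ → refl) d↝c)))

  related-self : ∀ d → T (related d (remQuot n (code d)))
  related-self d = subst (T ∘ related d) (sym (decode-code d))
    (≡true⇒T (cong (_∨ does (reach? (reverse d) d)) (dec-true (reach? d d) (reach-refl d))))

  orient-antisym : ∀ x y → ¬ Reach (x , y) (y , x) → orient y x ≡ not (orient x y)
  orient-antisym x y d↛d′ with firstTrue-found (λ k → related (x , y) (remQuot n k)) (code (x , y)) (related-self (x , y))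
  ... | k , found , rel = begin
    orient y x                                ≡⟨ cong (maybe′ (inOrbit (y , x)) false) same-candidate ⟩
    maybe′ (inOrbit (y , x)) false (candidate (x , y)) ≡⟨ cong (maybe′ (inOrbit (y , x)) false) found ⟩
    inOrbit (y , x) k                         ≡⟨ exactly-one (reach? (x , y) c) (reach? (y , x) c)
                                                             (disjoint-orbits (x , y) c d↛d′) rel ⟩
    not (inOrbit (x , y) k)                   ≡⟨ cong (not ∘ maybe′ (inOrbit (x , y)) false) found ⟨
    not (orient x y)                          ∎
    where
    open ≡-Reasoning
    c : Pair
    c = remQuot n k
    same-candidate : candidate (y , x) ≡ candidate (x , y)
    same-candidate = firstTrue-cong (λ j → ∨-comm (inOrbit (y , x) j) (inOrbit (x , y) j))

  -- If no power of σ reverses an edge, orient is a σ-invariant orientation, so σ flips no edge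
  -- with respect to it and σ is even.
  even-without-reversed-edges : (∀ x y → T (adj G x y) → ¬ Reach (x , y) (y , x)) → reversals G σ % 2 ≡ 0
  even-without-reversed-edges none = begin
    reversals G σ % 2
      ≡⟨ reversals-mod-2 G {σ} {orient} aut (λ x y xy → orient-antisym x y (none x y xy)) ⟩
    bit (parity (edgeCount G (flipped G orient σ)))
      ≡⟨ cong (bit ∘ parity) (edgeCount-cong G {flipped G orient σ} {λ _ _ → false} unflipped) ⟩
    bit (parity (edgeCount G (λ _ _ → false)))
      ≡⟨ cong (bit ∘ parity) (trans (count-cong empty) (count-empty {n})) ⟩
    0 ∎
    where
    open ≡-Reasoning
    unflipped : ∀ x y → T (adj G x y) → flipped G orient σ x y ≡ false
    unflipped x y _ = trans (cong (_xor orient x y) (orient-invariant x y)) (xor-same (orient x y))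
    empty : ∀ x y → (adj G x y ∧ x ≺ y ∧ false) ≡ false
    empty x y = trans (cong (adj G x y ∧_) (∧-zeroʳ (x ≺ y))) (∧-zeroʳ (adj G x y))

  odd⇒mirrorBridge : reversals G σ % 2 ≡ 1 → HasMirrorBridge G
  odd⇒mirrorBridge odd with any? (λ x → any? (λ y → T? (adj G x y) ×-dec reach? (x , y) (y , x)))
  ... | yes (x , y , xy , reversed) = x , y , reversed⇒mirrorBridge xy reversed
  ... | no none = contradiction (trans (sym odd) (even-without-reversed-edges λ x y xy r → none (x , y , xy , r))) λ ()

module Paths {n : ℕ} (G : Graph n) where

  open import Data.List.Membership.DecPropositional (_≟_ {n}) using (_∈?_)

  data Path : Fin n → Fin n → List (Fin n) → Set where
    end : ∀ {a} → Path a a (a ∷ [])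
    hop : ∀ {a c b xs} → T (adj G a c) → Path c b xs → Path a b (a ∷ xs)

  first∈ : ∀ {a b xs} → Path a b xs → a ∈ xs
  first∈ end = here refl
  first∈ (hop _ _) = here refl

  path-from : ∀ {a c b ys} → Path c b ys → a ∈ ys →
    ∃ λ zs → Path a b zs × zs ⊆ ys × (Unique ys → Unique zs)
  path-from end (here refl) = _ , end , id , id
  path-from (hop ca p) (here refl) = _ , hop ca p , id , id
  path-from (hop _ p) (there a∈ys) with path-from p a∈ys
  ... | zs , q , zs⊆ys , unique = zs , q , there ∘ zs⊆ys , λ { (_ ∷ u) → unique u }

  shortcut : ∀ {a b xs} → Path a b xs → ∃ λ ys → Path a b ys × Unique ys × ys ⊆ xs
  shortcut end = _ , end , ([] ∷ []) , id
  shortcut (hop {a} ac p) with shortcut p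
  ... | ys , q , unique , ys⊆xs with a ∈? ys
  ...   | yes a∈ys with path-from q a∈ys
  ...     | zs , r , zs⊆ys , unique-suffix = zs , r , unique-suffix unique , there ∘ ys⊆xs ∘ zs⊆ys
  shortcut (hop {a} ac p) | ys , q , unique , ys⊆xs | no a∉ys =
    a ∷ ys , hop ac q , ¬Any⇒All¬ ys a∉ys ∷ unique , λ { (here e) → here e ; (there m) → there (ys⊆xs m) }

  length≥2 : ∀ {a b xs} → Path a b xs → a ≢ b → 2 ≤ length xs
  length≥2 end a≢b = contradiction refl a≢b
  length≥2 (hop _ end) _ = s≤s (s≤s z≤n)
  length≥2 (hop _ (hop _ _)) _ = s≤s (s≤s z≤n)

  extended : ∀ {w a b z xs} → T (adj G w a) → Path a b xs → T (adj G b z) → IsPath G (w ∷ xs ++ z ∷ [])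
  extended wa end bz = cons wa (cons bz single)
  extended wa (hop ac p) bz = cons wa (extended ac p bz)

  close-cycle : ∀ {x p q xs} → Path x p xs → Unique xs → q ∉ xs → T (adj G q x) → T (adj G p q) → x ≢ p →
    HasCycle G
  close-cycle {q = q} {xs} path unique q∉xs qx pq x≢p =
    q , xs , length≥2 path x≢p , ¬Any⇒All¬ xs q∉xs ∷ unique , extended qx path pq

  map-path : ∀ (π : Permutation′ n) → IsAutomorphism G π → ∀ {a b xs} →
    Path a b xs → Path (π ⟨$⟩ʳ a) (π ⟨$⟩ʳ b) (map (π ⟨$⟩ʳ_) xs)
  map-path π aut end = end
  map-path π aut (hop {a} {c} ac p) = hop (subst T (sym (aut a c)) ac) (map-path π aut p)

  -- Near p q x: x is joined to p by a walk avoiding q; for an edge pq, x lies on p's side.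
  Near : Fin n → Fin n → Fin n → Set
  Near p q x = ∃ λ xs → Path x p xs × q ∉ xs

  near-self : ∀ {p q} → p ≢ q → Near p q p
  near-self p≢q = _ , end , λ { (here q≡p) → p≢q (sym q≡p) }

  near-extend : ∀ {p q x y} → Near p q y → T (adj G x y) → x ≢ q → Near p q x
  near-extend (xs , path , q∉xs) xy x≢q =
    _ , hop xy path , λ { (here q≡x) → x≢q (sym q≡x) ; (there q∈xs) → q∉xs q∈xs }

  near-map : ∀ (π : Permutation′ n) → IsAutomorphism G π → ∀ {p q x} →
    Near p q x → Near (π ⟨$⟩ʳ p) (π ⟨$⟩ʳ q) (π ⟨$⟩ʳ x)
  near-map π aut {q = q} (xs , path , q∉xs) = _ , map-path π aut path , q∉xs ∘ pull-back
    where
    pull-back : π ⟨$⟩ʳ q ∈ map (π ⟨$⟩ʳ_) xs → q ∈ xs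
    pull-back πq∈ with ∈-map⁻ (π ⟨$⟩ʳ_) πq∈
    ... | z , z∈xs , πq≡πz = subst (_∈ xs) (sym (⟨$⟩ʳ-injective π πq≡πz)) z∈xs

  near-exchange : ∀ (π : Permutation′ n) → IsAutomorphism G π → ∀ {p q x} →
    π ⟨$⟩ʳ p ≡ q → π ⟨$⟩ʳ q ≡ p → Near p q x → Near q p (π ⟨$⟩ʳ x)
  near-exchange π aut πp≡q πq≡p near = subst₂ (λ a b → Near a b _) πp≡q πq≡p (near-map π aut near)

  near-neighbour : ¬ HasCycle G → ∀ {p q x} → T (adj G p q) → Near p q x → T (adj G x q) → x ≡ p
  near-neighbour acyclic {p} {q} {x} pq (xs , path , q∉xs) xq with x ≟ p
  ... | yes x≡p = x≡p
  ... | no x≢p with shortcut path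
  ...   | ys , path′ , unique , ys⊆xs =
    contradiction (close-cycle path′ unique (q∉xs ∘ ys⊆xs) (adj-sym G xq) pq x≢p) acyclic

  module EdgeSides (tree : IsTree G) {u v : Fin n} (uv : T (adj G u v)) where

    u≢v : u ≢ v
    u≢v = adj⇒≢ G uv

    -- Every vertex lies on a side: follow a walk to u.
    sides-cover : ∀ {x} → Walk G x u → Near u v x ⊎ Near v u x
    sides-cover here = inj₁ (near-self u≢v)
    sides-cover (step {x} xw walk) with sides-cover walk | x ≟ u | x ≟ v
    ... | _ | yes refl | _ = inj₁ (near-self u≢v)
    ... | _ | no _ | yes refl = inj₂ (near-self (u≢v ∘ sym))
    ... | inj₁ near-u | no _ | no x≢v = inj₁ (near-extend near-u xw x≢v)
    ... | inj₂ near-v | no x≢u | no _ = inj₂ (near-extend near-v xw x≢u)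

    -- No vertex lies on both sides: a walk from u's side to v avoiding u would have to use uv.
    sides-disjoint : ∀ {x} → Near u v x → ¬ Near v u x
    sides-disjoint near-u (xs , path , u∉xs) = reach-v near-u path u∉xs
      where
      reach-v : ∀ {x xs} → Near u v x → Path x v xs → u ∉ xs → ⊥
      reach-v (ys , path-u , v∉ys) end _ = v∉ys (first∈ path-u)
      reach-v {x} near-u (hop {c = c} xc path) u∉xs with c ≟ v
      ... | yes refl = u∉xs (here (sym (near-neighbour (proj₂ (proj₂ tree)) uv near-u xc)))
      ... | no c≢v = reach-v (near-extend near-u (adj-sym G xc) c≢v) path (u∉xs ∘ there)

    crossing : ∀ {x y} → Near u v x → Near v u y → T (adj G x y) → x ≡ u × y ≡ v
    crossing {x} {y} near-u near-v xy with y ≟ v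
    ... | yes y≡v = near-neighbour (proj₂ (proj₂ tree)) uv near-u (subst (T ∘ adj G x) y≡v xy) , y≡v
    ... | no y≢v = contradiction near-v (sides-disjoint (near-extend near-u (adj-sym G xy) y≢v))

module Folding {n : ℕ} (G : Graph n) (tree : IsTree G) {u v : Fin n} (uv : T (adj G u v))
               (σ : Permutation′ n) (aut : IsAutomorphism G σ)
               (σu≡v : σ ⟨$⟩ʳ u ≡ v) (σv≡u : σ ⟨$⟩ʳ v ≡ u) where

  open Paths G
  open EdgeSides tree uv

  σ⁻¹ : Permutation′ n
  σ⁻¹ = inverse σ

  σ⁻¹u≡v : σ⁻¹ ⟨$⟩ʳ u ≡ v
  σ⁻¹u≡v = trans (cong (σ ⟨$⟩ˡ_) (sym σv≡u)) (inverseˡ σ)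

  σ⁻¹v≡u : σ⁻¹ ⟨$⟩ʳ v ≡ u
  σ⁻¹v≡u = trans (cong (σ ⟨$⟩ˡ_) (sym σu≡v)) (inverseˡ σ)

  -- Every vertex lies on exactly one side, so being on u's side is decidable.
  side : ∀ x → Near u v x ⊎ Near v u x
  side x = sides-cover (proj₁ (proj₂ tree) x u)

  onU? : ∀ x → Dec (Near u v x)
  onU? x = Sum.[ yes , (λ near-v → no (λ near-u → sides-disjoint near-u near-v)) ]′ (side x)

  onU-true : ∀ {x} → Near u v x → does (onU? x) ≡ true
  onU-true {x} = dec-true (onU? x)

  onU-false : ∀ {x} → Near v u x → does (onU? x) ≡ false
  onU-false {x} near-v = dec-false (onU? x) (λ near-u → sides-disjoint near-u near-v)

  fold : Fin n → Fin n
  fold x = if does (onU? x) then σ ⟨$⟩ʳ x else σ⁻¹ ⟨$⟩ʳ x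

  fold-u : ∀ {x} → Near u v x → fold x ≡ σ ⟨$⟩ʳ x
  fold-u {x} near-u = cong (λ b → if b then σ ⟨$⟩ʳ x else σ⁻¹ ⟨$⟩ʳ x) (onU-true near-u)

  fold-v : ∀ {x} → Near v u x → fold x ≡ σ⁻¹ ⟨$⟩ʳ x
  fold-v {x} near-v = cong (λ b → if b then σ ⟨$⟩ʳ x else σ⁻¹ ⟨$⟩ʳ x) (onU-false near-v)

  σ-exchange : ∀ {x} → Near u v x → Near v u (σ ⟨$⟩ʳ x)
  σ-exchange = near-exchange σ aut σu≡v σv≡u

  σ⁻¹-exchange : ∀ {x} → Near v u x → Near u v (σ⁻¹ ⟨$⟩ʳ x)
  σ⁻¹-exchange = near-exchange σ⁻¹ (inverse-automorphism G {σ} aut) σ⁻¹v≡u σ⁻¹u≡v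

  fold-u→v : ∀ {x} → Near u v x → Near v u (fold x)
  fold-u→v near-u = subst (Near v u) (sym (fold-u near-u)) (σ-exchange near-u)

  fold-v→u : ∀ {x} → Near v u x → Near u v (fold x)
  fold-v→u near-v = subst (Near u v) (sym (fold-v near-v)) (σ⁻¹-exchange near-v)

  fold-involutive : ∀ x → fold (fold x) ≡ x
  fold-involutive x = Sum.[ on-u , on-v ]′ (side x)
    where
    on-u : Near u v x → fold (fold x) ≡ x
    on-u near-u = trans (fold-v (fold-u→v near-u)) (trans (cong (σ ⟨$⟩ˡ_) (fold-u near-u)) (inverseˡ σ))
    on-v : Near v u x → fold (fold x) ≡ x
    on-v near-v = trans (fold-u (fold-v→u near-v)) (trans (cong (σ ⟨$⟩ʳ_) (fold-v near-v)) (inverseʳ σ))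

  foldₚ : Permutation′ n
  foldₚ = permutation fold fold fold-involutive fold-involutive

  -- uv is the only edge between the sides, and the folding maps it to itself.
  fold-cross : ∀ {x y} → Near u v x → Near v u y → adj G (σ ⟨$⟩ʳ x) (σ⁻¹ ⟨$⟩ʳ y) ≡ adj G x y
  fold-cross {x} {y} near-u near-v =
    does-⇔ (mk⇔ to from) (T? (adj G (σ ⟨$⟩ʳ x) (σ⁻¹ ⟨$⟩ʳ y))) (T? (adj G x y))
    where
    to : T (adj G (σ ⟨$⟩ʳ x) (σ⁻¹ ⟨$⟩ʳ y)) → T (adj G x y)
    to σxσ⁻¹y with crossing (σ⁻¹-exchange near-v) (σ-exchange near-u) (adj-sym G σxσ⁻¹y)
    ... | σ⁻¹y≡u , σx≡v = subst₂ (λ a b → T (adj G a b))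
      (⟨$⟩ʳ-injective σ (trans σu≡v (sym σx≡v))) (⟨$⟩ʳ-injective σ⁻¹ (trans σ⁻¹v≡u (sym σ⁻¹y≡u))) uv
    from : T (adj G x y) → T (adj G (σ ⟨$⟩ʳ x) (σ⁻¹ ⟨$⟩ʳ y))
    from xy with crossing near-u near-v xy
    ... | refl , refl = subst₂ (λ a b → T (adj G a b)) (sym σu≡v) (sym σ⁻¹v≡u) (adj-sym G uv)

  fold-adj : ∀ {x y} → Near u v x ⊎ Near v u x → Near u v y ⊎ Near v u y → adj G (fold x) (fold y) ≡ adj G x y
  fold-adj {x} {y} (inj₁ near-u) (inj₁ near-u′) = trans (cong₂ (adj G) (fold-u near-u) (fold-u near-u′)) (aut x y)
  fold-adj {x} {y} (inj₂ near-v) (inj₂ near-v′) =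
    trans (cong₂ (adj G) (fold-v near-v) (fold-v near-v′)) (inverse-automorphism G {σ} aut x y)
  fold-adj (inj₁ near-u) (inj₂ near-v) = trans (cong₂ (adj G) (fold-u near-u) (fold-v near-v)) (fold-cross near-u near-v)
  fold-adj {x} {y} (inj₂ near-v) (inj₁ near-u) = begin
    adj G (fold x) (fold y)              ≡⟨ cong₂ (adj G) (fold-v near-v) (fold-u near-u) ⟩
    adj G (σ⁻¹ ⟨$⟩ʳ x) (σ ⟨$⟩ʳ y)        ≡⟨ Graph.sym G _ _ ⟩
    adj G (σ ⟨$⟩ʳ y) (σ⁻¹ ⟨$⟩ʳ x)        ≡⟨ fold-cross near-u near-v ⟩
    adj G y x                            ≡⟨ Graph.sym G y x ⟩
    adj G x y                            ∎
    where open ≡-Reasoning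

  fold-automorphism : IsAutomorphism G foldₚ
  fold-automorphism x y = fold-adj (side x) (side y)

  orientBy : Bool → Bool → Fin n → Fin n → Bool
  orientBy true true x y = x ≺ y
  orientBy false false x y = fold x ≺ fold y
  orientBy true false _ _ = true
  orientBy false true _ _ = false

  orientation : Fin n → Fin n → Bool
  orientation x y = orientBy (does (onU? x)) (does (onU? y)) x y

  orientation-uu : ∀ {x y} → Near u v x → Near u v y → orientation x y ≡ x ≺ y
  orientation-uu nx ny = cong₂ (λ a b → orientBy a b _ _) (onU-true nx) (onU-true ny)

  orientation-vv : ∀ {x y} → Near v u x → Near v u y → orientation x y ≡ fold x ≺ fold y
  orientation-vv nx ny = cong₂ (λ a b → orientBy a b _ _) (onU-false nx) (onU-false ny)

  orientation-uv : ∀ {x y} → Near u v x → Near v u y → orientation x y ≡ true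
  orientation-uv nx ny = cong₂ (λ a b → orientBy a b _ _) (onU-true nx) (onU-false ny)

  orientation-vu : ∀ {x y} → Near v u x → Near u v y → orientation x y ≡ false
  orientation-vu nx ny = cong₂ (λ a b → orientBy a b _ _) (onU-false nx) (onU-true ny)

  -- It is an orientation: on v's side because fold is injective, across uv by definition.
  orientation-antisym : ∀ {x y} → T (adj G x y) → Near u v x ⊎ Near v u x → Near u v y ⊎ Near v u y →
    orientation y x ≡ not (orientation x y)
  orientation-antisym {x} {y} xy (inj₁ nx) (inj₁ ny) =
    trans (orientation-uu ny nx) (trans (≺-isOrientation G x y xy) (cong not (sym (orientation-uu nx ny))))
  orientation-antisym {x} {y} xy (inj₂ nx) (inj₂ ny) =
    trans (orientation-vv ny nx) (trans (≺-isOrientation G (fold x) (fold y) fxfy) (cong not (sym (orientation-vv nx ny))))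
    where
    fxfy : T (adj G (fold x) (fold y))
    fxfy = subst T (sym (fold-automorphism x y)) xy
  orientation-antisym xy (inj₁ nx) (inj₂ ny) = trans (orientation-vu ny nx) (cong not (sym (orientation-uv nx ny)))
  orientation-antisym xy (inj₂ nx) (inj₁ ny) = trans (orientation-uv ny nx) (cong not (sym (orientation-vu nx ny)))

  orientation-isOrientation : IsOrientation G orientation
  orientation-isOrientation x y xy = orientation-antisym xy (side x) (side y)

  v-not-near-u : ¬ Near u v v
  v-not-near-u near = sides-disjoint near (near-self (u≢v ∘ sym))

  u-not-near-v : ¬ Near v u u
  u-not-near-v = sides-disjoint (near-self u≢v)

  flipped-fold : ∀ {x y} → T (adj G x y) → Near u v x ⊎ Near v u x → Near u v y ⊎ Near v u y →
    flipped G orientation foldₚ x y ≡ does (pair? u v x y)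
  flipped-fold {x} {y} _ (inj₁ nx) (inj₁ ny) = begin
    orientation (fold x) (fold y) xor orientation x y
      ≡⟨ cong₂ _xor_ (orientation-vv (fold-u→v nx) (fold-u→v ny)) (orientation-uu nx ny) ⟩
    (fold (fold x) ≺ fold (fold y)) xor (x ≺ y)
      ≡⟨ cong₂ (λ a b → (a ≺ b) xor (x ≺ y)) (fold-involutive x) (fold-involutive y) ⟩
    (x ≺ y) xor (x ≺ y)
      ≡⟨ xor-same (x ≺ y) ⟩
    false
      ≡⟨ dec-false (pair? u v x y)
                   (λ { (inj₁ (_ , refl)) → v-not-near-u ny ; (inj₂ (refl , _)) → v-not-near-u nx }) ⟨
    does (pair? u v x y) ∎
    where open ≡-Reasoning
  flipped-fold {x} {y} _ (inj₂ nx) (inj₂ ny) = begin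
    orientation (fold x) (fold y) xor orientation x y
      ≡⟨ cong₂ _xor_ (orientation-uu (fold-v→u nx) (fold-v→u ny)) (orientation-vv nx ny) ⟩
    (fold x ≺ fold y) xor (fold x ≺ fold y)
      ≡⟨ xor-same (fold x ≺ fold y) ⟩
    false
      ≡⟨ dec-false (pair? u v x y)
                   (λ { (inj₁ (refl , _)) → u-not-near-v nx ; (inj₂ (_ , refl)) → u-not-near-v ny }) ⟨
    does (pair? u v x y) ∎
    where open ≡-Reasoning
  flipped-fold xy (inj₁ nx) (inj₂ ny) with crossing nx ny xy
  ... | refl , refl = begin
    orientation (fold u) (fold v) xor orientation u v
      ≡⟨ cong₂ _xor_ (orientation-vu (fold-u→v nx) (fold-v→u ny)) (orientation-uv nx ny) ⟩
    true
      ≡⟨ dec-true (pair? u v u v) (inj₁ (refl , refl)) ⟨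
    does (pair? u v u v) ∎
    where open ≡-Reasoning
  flipped-fold xy (inj₂ nx) (inj₁ ny) with crossing ny nx (adj-sym G xy)
  ... | refl , refl = begin
    orientation (fold v) (fold u) xor orientation v u
      ≡⟨ cong₂ _xor_ (orientation-uv (fold-v→u nx) (fold-u→v ny)) (orientation-vu nx ny) ⟩
    true
      ≡⟨ dec-true (pair? u v v u) (inj₂ (refl , refl)) ⟨
    does (pair? u v v u) ∎
    where open ≡-Reasoning

  fold-odd : reversals G foldₚ % 2 ≡ 1
  fold-odd = begin
    reversals G foldₚ % 2
      ≡⟨ reversals-mod-2 G {foldₚ} {orientation} fold-automorphism orientation-isOrientation ⟩
    bit (parity (edgeCount G (flipped G orientation foldₚ)))
      ≡⟨ cong (bit ∘ parity) (edgeCount-cong G (λ x y xy → flipped-fold xy (side x) (side y))) ⟩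
    bit (parity (edgeCount G (λ x y → does (pair? u v x y))))
      ≡⟨ cong (bit ∘ parity) (edgeCount-pair G uv) ⟩
    1 ∎
    where open ≡-Reasoning

lemma5p4 : (n : ℕ) (T : Graph n) → IsTree T → (IsOddGraph T ⇔ HasMirrorBridge T)
lemma5p4 n G tree = mk⇔ odd⇒mirror-bridge mirror-bridge⇒odd
  where
  odd⇒mirror-bridge : IsOddGraph G → HasMirrorBridge G
  odd⇒mirror-bridge (σ , aut , odd) = PairOrbits.odd⇒mirrorBridge G σ aut odd
  mirror-bridge⇒odd : HasMirrorBridge G → IsOddGraph G
  mirror-bridge⇒odd (u , v , uv , σ , aut , σu≡v , σv≡u) = foldₚ , fold-automorphism , fold-odd
    where open Folding G tree uv σ aut σu≡v σv≡u
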